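{- Let $f:B\to A$ and $g:C\to A$ be two covers, and let $B\xleftarrow{p}U\xrightarrow{q}C$ be a pullback (in $\mathbf C$) of $B\xrightarrow{f}A\xleftarrow{g}C$. For every $i\in\Sigma(U)$ with $\deg(q\circ i)=1$ the cover $q\circ i$ is an isomorphism, and the map $$\Phi:\{i\in\Sigma(U)\mid \deg(q\circ i)=1\}\to {\rm Hom}(g,f),\qquad i\mapsto p\circ i\circ (q\circ i)^{ -1}$$ is a well-defined bijection. In particular $|{\rm Hom}(g,f)|\le \deg f$, with equality if and only if $\deg(q\circ i)=1$ for all $i\in\Sigma(U)$.
   Context: Let $\mathbf C$ be a category and $\mathbf D$ a full subcategory of $\mathbf C$. For arrows $f,g$ of $\mathbf C$ with ${\rm cod}\,f={\rm cod}\,g$, ${\rm Hom}(g,f)$ denotes the collection of all arrows $h$ of $\mathbf C$ with $g=f\circ h$. Standing assumptions: (G1) every diagram $B\to A\leftarrow C$ in $\mathbf D$ has a pullback in $\mathbf C$. (G2) (I) pushouts exist in $\mathbf D$; (II) every arrow of $\mathbf D$ is epic; (III) every monic arrow of $\mathbf D$ is an isomorphism whose inverse is an arrow of $\mathbf D$. (G3) for every object $U$ of $\mathbf C$ there is a set $\Sigma(U)$ of arrows $i$ of $\mathbf C$ with ${\rm dom}\,i$ in $\mathbf D$ and ${\rm cod}\,i=U$ such that for every arrow $u$ of $\mathbf C$ with ${\rm dom}\,u$ in $\mathbf D$ and ${\rm cod}\,u=U$ there is exactly one $i\in\Sigma(U)$ with ${\rm Hom}(u,i)\neq\emptyset$.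 (G4) there is a function $\deg$ from the collection of arrows of $\mathbf C$ whose codomain lies in $\mathbf D$ to the positive integers such that (I) $\deg(g\circ f)=\deg g\cdot\deg f$ whenever $f,g,g\circ f$ all lie in this collection; (II) $\deg f=\sum_{i\in\Sigma({\rm dom}\,f)}\deg(f\circ i)$ for every such $f$; (III) if $B\xrightarrow{f}A\xleftarrow{g}C$ is a diagram in $\mathbf D$ with pullback $B\xleftarrow{p}U\xrightarrow{q}C$, then $\deg f=\deg q$ and $\deg g=\deg p$. A cover is an arrow of $\mathbf D$. -}

module Defs where

open import Level using (Level; _⊔_)
open import Data.Nat using (ℕ; zero; suc; _+_; _*_; _≤_)
open import Data.Fin using (Fin)
open import Data.Product using (Σ; Σ-syntax; ∃; ∃-syntax; _×_; _,_; proj₁; proj₂)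
open import Relation.Binary.PropositionalEquality using (_≡_)
open import Function.Bundles using (_↔_; Inverse)

sumFin : (n : ℕ) → (Fin n → ℕ) → ℕ
sumFin zero    a = 0
sumFin (suc n) a = a Fin.zero + sumFin n (λ k → a (Fin.suc k))

record Category (o ℓ : Level) : Set (Level.suc (o ⊔ ℓ)) where
  infixr 9 _∘_
  field
    Obj       : Set o
    Hom       : Obj → Obj → Set ℓ
    id        : ∀ {A} → Hom A A
    _∘_       : ∀ {A B C} → Hom B C → Hom A B → Hom A C
    assoc     : ∀ {A B C D} (h : Hom C D) (g : Hom B C) (f : Hom A B) →
                (h ∘ g) ∘ f ≡ h ∘ (g ∘ f)
    identityˡ : ∀ {A B} (f : Hom A B) → id ∘ f ≡ f
    identityʳ : ∀ {A B} (f : Hom A B) → f ∘ id ≡ f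
    Hom-isSet : ∀ {A B} {f g : Hom A B} (p q : f ≡ g) → p ≡ q

module CatNotions {o ℓ : Level} (𝐂 : Category o ℓ) where
  open Category 𝐂

  IsInverse : ∀ {A B} → Hom A B → Hom B A → Set ℓ
  IsInverse f r = (r ∘ f ≡ id) × (f ∘ r ≡ id)

  IsIso : ∀ {A B} → Hom A B → Set ℓ
  IsIso f = ∃[ r ] IsInverse f r

  HomOver : ∀ {A B C} → Hom C A → Hom B A → Set ℓ
  HomOver g f = Σ[ h ∈ Hom _ _ ] (g ≡ f ∘ h)

  IsPullback : ∀ {A B C U} → Hom B A → Hom C A → Hom U B → Hom U C → Set (o ⊔ ℓ)
  IsPullback {A} {B} {C} {U} f g p q =
    (f ∘ p ≡ g ∘ q) ×
    (∀ {V} (p' : Hom V B) (q' : Hom V C) → f ∘ p' ≡ g ∘ q' →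
       Σ[ u ∈ Hom V U ] ((p ∘ u ≡ p') × (q ∘ u ≡ q') ×
         (∀ (u' : Hom V U) → p ∘ u' ≡ p' → q ∘ u' ≡ q' → u' ≡ u)))

record GaloisSetting (o ℓ : Level) : Set (Level.suc (o ⊔ ℓ)) where
  field
    𝐂 : Category o ℓ
  open Category 𝐂
  open CatNotions 𝐂
  field
    -- full subcategory 𝐃 : objects satisfying 𝐃ob; arrows = all 𝐂-arrows between them
    𝐃ob      : Obj → Set o
    𝐃ob-prop : ∀ {X} (d d' : 𝐃ob X) → d ≡ d'

    G1 : ∀ {A B C} → 𝐃ob A → 𝐃ob B → 𝐃ob C → (f : Hom B A) (g : Hom C A) →
         Σ[ U ∈ Obj ] Σ[ p ∈ Hom U B ] Σ[ q ∈ Hom U C ] IsPullback f g p q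

    G2-pushout : ∀ {A B C} → 𝐃ob A → 𝐃ob B → 𝐃ob C → (f : Hom A B) (g : Hom A C) →
         Σ[ P ∈ Obj ] 𝐃ob P × (Σ[ j ∈ Hom B P ] Σ[ k ∈ Hom C P ]
           ((j ∘ f ≡ k ∘ g) ×
            (∀ {Q} → 𝐃ob Q → (j' : Hom B Q) (k' : Hom C Q) → j' ∘ f ≡ k' ∘ g →
               Σ[ u ∈ Hom P Q ] ((u ∘ j ≡ j') × (u ∘ k ≡ k') ×
                 (∀ (u' : Hom P Q) → u' ∘ j ≡ j' → u' ∘ k ≡ k' → u' ≡ u)))))
    G2-epi : ∀ {A B X} → 𝐃ob A → 𝐃ob B → 𝐃ob X → (f : Hom A B) (u v : Hom B X) →
             u ∘ f ≡ v ∘ f → u ≡ v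
    -- (G2)(III) every monic arrow of 𝐃 (monic in 𝐃) is an isomorphism
    -- (its inverse is automatically an arrow of 𝐃, 𝐃 being full)
    G2-mono : ∀ {A B} → 𝐃ob A → 𝐃ob B → (f : Hom A B) →
              (∀ {X} → 𝐃ob X → (u v : Hom X A) → f ∘ u ≡ f ∘ v → u ≡ v) →
              IsIso f

    -- (G3) the sets Σ(U): an index type, and for each index an arrow
    -- into U whose domain lies in 𝐃
    Σidx  : Obj → Set ℓ
    Σdom  : ∀ {U} → Σidx U → Obj
    Σdom𝐃 : ∀ {U} (i : Σidx U) → 𝐃ob (Σdom i)
    Σarr  : ∀ {U} (i : Σidx U) → Hom (Σdom i) U
    G3-exists : ∀ {U X} → 𝐃ob X → (u : Hom X U) →
                Σ[ i ∈ Σidx U ] HomOver u (Σarr i)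
    G3-unique : ∀ {U X} → 𝐃ob X → (u : Hom X U) (i j : Σidx U) →
                HomOver u (Σarr i) → HomOver u (Σarr j) → i ≡ j

    deg      : ∀ {X Y} → 𝐃ob Y → Hom X Y → ℕ
    deg-pos  : ∀ {X Y} (d : 𝐃ob Y) (f : Hom X Y) → 1 ≤ deg d f
    G4-mult  : ∀ {X Y Z} (dY : 𝐃ob Y) (dZ : 𝐃ob Z) (f : Hom X Y) (g : Hom Y Z) →
               deg dZ (g ∘ f) ≡ deg dZ g * deg dY f
    G4-sum   : ∀ {X Y} (d : 𝐃ob Y) (f : Hom X Y) →
               Σ[ n ∈ ℕ ] Σ[ e ∈ (Fin n ↔ Σidx X) ]
                 deg d f ≡ sumFin n (λ k → deg d (f ∘ Σarr (Inverse.to e k)))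
    G4-pb    : ∀ {A B C U} (dA : 𝐃ob A) (dB : 𝐃ob B) (dC : 𝐃ob C)
               (f : Hom B A) (g : Hom C A) (p : Hom U B) (q : Hom U C) →
               IsPullback f g p q → (deg dA f ≡ deg dC q) × (deg dA g ≡ deg dB p)

{-# OPTIONS --safe #-}
module Submission where

-- By the universal property of the pullback, the arrows h with g = f ∘ h are
-- the sections u of q.  A section factors as u = i ∘ k with i ∈ Σ(U), and then
-- q ∘ i has the right inverse k, so deg (q ∘ i) = 1.  Conversely a cover of
-- degree one is monic, hence an isomorphism by (G2)(III): one leg of its kernel
-- pair has degree one, so Σ of the kernel pair has a single element, through
-- which the diagonal factors, and since covers are epic the two legs agree.
-- Hence Hom(g , f) ≅ { i ∈ Σ(U) | deg (q ∘ i) = 1 }, and the count follows from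
-- deg f = deg q = Σᵢ deg (q ∘ i), a sum of positive terms.

open import Defs
open import Data.Nat using (ℕ; _≤_)
open import Data.Fin using (Fin)
open import Data.Product using (Σ; Σ-syntax; _×_; _,_; proj₁; proj₂)
open import Relation.Binary.PropositionalEquality using (_≡_)
open import Function.Definitions using (Bijective)
open import Function.Bundles using (_↔_; _⇔_)

open import Data.Nat using (zero; suc; _+_; _*_; z≤n; s≤s)
open import Data.Nat.Properties
open import Data.Fin using (zero; suc)
open import Data.Fin.Properties using (+↔⊎)
open import Data.Product.Function.Dependent.Propositional using (Σ-↔)
open import Data.Sum using (_⊎_; inj₁; inj₂)
open import Data.Sum.Function.Propositional using (_⊎-↔_)
open import Function.Bundles using (Inverse; Bijection; mk↔ₛ′; mk⇔)
open import Function.Properties.Inverse using (↔-refl; ↔-sym; ↔-trans; Inverse⇒Bijection)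
open import Relation.Binary.PropositionalEquality using (refl; sym; trans; cong; cong₂; subst; module ≡-Reasoning)

module _ where
  open import Function.Base using (_∘_)

  +-mono-≤-rigid : ∀ {w x y z} → w ≤ y → x ≤ z → w + x ≡ y + z → w ≡ y × x ≡ z
  +-mono-≤-rigid {w} {x} {y} {z} w≤y x≤z eq = w≡y , +-cancelˡ-≡ y x z (trans (cong (_+ x) (sym w≡y)) eq)
    where
    open ≤-Reasoning
    w≡y : w ≡ y
    w≡y = ≤-antisym w≤y (+-cancelʳ-≤ z y w (begin
      y + z ≡⟨ sym eq ⟩
      w + x ≤⟨ +-monoʳ-≤ w x≤z ⟩
      w + z ∎))

  sumFin-cong : ∀ m {a b : Fin m → ℕ} → (∀ k → a k ≡ b k) → sumFin m a ≡ sumFin m b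
  sumFin-cong zero    a≡b = refl
  sumFin-cong (suc m) a≡b = cong₂ _+_ (a≡b zero) (sumFin-cong m (a≡b ∘ suc))

  sumFin-mono-≤ : ∀ m {a b : Fin m → ℕ} → (∀ k → a k ≤ b k) → sumFin m a ≤ sumFin m b
  sumFin-mono-≤ zero    a≤b = z≤n
  sumFin-mono-≤ (suc m) a≤b = +-mono-≤ (a≤b zero) (sumFin-mono-≤ m (a≤b ∘ suc))

  sumFin-mono-≤-rigid : ∀ m {a b : Fin m → ℕ} → (∀ k → a k ≤ b k) →
                        sumFin m a ≡ sumFin m b → ∀ k → a k ≡ b k
  sumFin-mono-≤-rigid (suc m) a≤b eq zero =
    proj₁ (+-mono-≤-rigid (a≤b zero) (sumFin-mono-≤ m (a≤b ∘ suc)) eq)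
  sumFin-mono-≤-rigid (suc m) a≤b eq (suc k) =
    sumFin-mono-≤-rigid m (a≤b ∘ suc)
      (proj₂ (+-mono-≤-rigid (a≤b zero) (sumFin-mono-≤ m (a≤b ∘ suc)) eq)) k

  length≤sumFin : ∀ m {a : Fin m → ℕ} → (∀ k → 1 ≤ a k) → m ≤ sumFin m a
  length≤sumFin zero    pos = z≤n
  length≤sumFin (suc m) pos = +-mono-≤ (pos zero) (length≤sumFin m (pos ∘ suc))

  isOne : ℕ → ℕ
  isOne 1 = 1
  isOne _ = 0

  isOne-≤ : ∀ n → isOne n ≤ n
  isOne-≤ zero          = z≤n
  isOne-≤ 1             = ≤-refl
  isOne-≤ (suc (suc _)) = z≤n

  isOne-fixes-1 : ∀ {n} → n ≡ 1 → isOne n ≡ n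
  isOne-fixes-1 refl = refl

  isOne-fixed⇒≡1 : ∀ {n} → 1 ≤ n → isOne n ≡ n → n ≡ 1
  isOne-fixed⇒≡1 {1} _ _ = refl
  isOne-fixed⇒≡1 {suc (suc _)} _ ()

  Fin-isOne↔ : ∀ n → Fin (isOne n) ↔ (n ≡ 1)
  Fin-isOne↔ zero          = mk↔ₛ′ (λ ()) (λ ()) (λ ()) (λ ())
  Fin-isOne↔ 1             = mk↔ₛ′ (λ _ → refl) (λ _ → zero) (λ _ → ≡-irrelevant _ _) (λ { zero → refl })
  Fin-isOne↔ (suc (suc _)) = mk↔ₛ′ (λ ()) (λ ()) (λ ()) (λ ())

  Σ-Fin-suc↔ : ∀ {p} {m} {P : Fin (suc m) → Set p} →
               Σ (Fin (suc m)) P ↔ (P zero ⊎ Σ (Fin m) (P ∘ suc))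
  Σ-Fin-suc↔ {P = P} = mk↔ₛ′ to from (λ { (inj₁ _) → refl ; (inj₂ _) → refl })
                                      (λ { (zero , _) → refl ; (suc _ , _) → refl })
    where
    to : Σ _ P → P zero ⊎ Σ _ (P ∘ suc)
    to (zero  , x) = inj₁ x
    to (suc k , x) = inj₂ (k , x)
    from : P zero ⊎ Σ _ (P ∘ suc) → Σ _ P
    from (inj₁ x)       = zero , x
    from (inj₂ (k , x)) = suc k , x

  Fin-ones↔ : ∀ m (a : Fin m → ℕ) → Fin (sumFin m (isOne ∘ a)) ↔ (Σ[ k ∈ Fin m ] a k ≡ 1)
  Fin-ones↔ zero    a = mk↔ₛ′ (λ ()) (λ ()) (λ ()) (λ ())
  Fin-ones↔ (suc m) a =
    ↔-trans +↔⊎ (↔-trans (Fin-isOne↔ (a zero) ⊎-↔ Fin-ones↔ m (a ∘ suc)) (↔-sym Σ-Fin-suc↔))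

  ones-count : ∀ {i} {I : Set i} {m} (e : Fin m ↔ I) (w : I → ℕ) → (∀ x → 1 ≤ w x) →
               ∀ {total} → total ≡ sumFin m (w ∘ Inverse.to e) →
               Σ[ n ∈ ℕ ] Σ[ _ ∈ (Fin n ↔ (Σ[ x ∈ I ] w x ≡ 1)) ]
                 ((n ≤ total) × (n ≡ total ⇔ (∀ x → w x ≡ 1)))
  ones-count {m = m} e w pos refl =
    sumFin m (isOne ∘ a) , ↔-trans (Fin-ones↔ m a) (Σ-↔ e ↔-refl) ,
    sumFin-mono-≤ m (isOne-≤ ∘ a) , mk⇔ all-one one-all
    where
    open Inverse e
    a : Fin m → ℕ
    a = w ∘ to
    all-one : sumFin m (isOne ∘ a) ≡ sumFin m a → ∀ x → w x ≡ 1
    all-one eq x = subst (λ y → w y ≡ 1) (strictlyInverseˡ x)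
      (isOne-fixed⇒≡1 (pos _) (sumFin-mono-≤-rigid m (isOne-≤ ∘ a) eq (from x)))
    one-all : (∀ x → w x ≡ 1) → sumFin m (isOne ∘ a) ≡ sumFin m a
    one-all ones = sumFin-cong m (λ k → isOne-fixes-1 (ones (to k)))

Σ-≡-irrelevant : ∀ {a b} {A : Set a} {P : A → Set b} → (∀ {x} (u v : P x) → u ≡ v) →
                 ∀ {x y} {u : P x} {v : P y} → x ≡ y → _≡_ {A = Σ A P} (x , u) (y , v)
Σ-≡-irrelevant irr refl = cong (_ ,_) (irr _ _)

module _ {o ℓ} (𝐂 : Category o ℓ) where
  open Category 𝐂
  open CatNotions 𝐂

  Section : ∀ {U C} → Hom U C → Set ℓ
  Section {U} {C} q = Σ[ u ∈ Hom C U ] q ∘ u ≡ id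

  ∘-factor : ∀ {X Y Z W} {a : Hom Y W} {u : Hom X Y} {s : Hom Z Y} {k : Hom X Z} →
             u ≡ s ∘ k → a ∘ u ≡ (a ∘ s) ∘ k
  ∘-factor {a = a} u≡sk = trans (cong (a ∘_) u≡sk) (sym (assoc _ _ _))

  left-inverse≡right-inverse : ∀ {X Y} {h : Hom X Y} {r r′ : Hom Y X} →
                               r ∘ h ≡ id → h ∘ r′ ≡ id → r ≡ r′
  left-inverse≡right-inverse {h = h} {r} {r′} rh≡id hr′≡id = begin
    r             ≡⟨ sym (identityʳ r) ⟩
    r ∘ id        ≡⟨ cong (r ∘_) (sym hr′≡id) ⟩
    r ∘ (h ∘ r′)  ≡⟨ ∘-factor refl ⟩
    (r ∘ h) ∘ r′  ≡⟨ cong (_∘ r′) rh≡id ⟩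
    id ∘ r′       ≡⟨ identityˡ r′ ⟩
    r′            ∎
    where open ≡-Reasoning

  Section↔HomOver : ∀ {A B C U} {f : Hom B A} {g : Hom C A} {p : Hom U B} {q : Hom U C} →
                    IsPullback f g p q → Section q ↔ HomOver g f
  Section↔HomOver {C = C} {U} {f} {g} {p} {q} (commutes , universal) = mk↔ₛ′ to from to∘from from∘to
    where
    to : Section q → HomOver g f
    to (u , qu≡id) = p ∘ u , (begin
      g              ≡⟨ sym (identityʳ g) ⟩
      g ∘ id         ≡⟨ cong (g ∘_) (sym qu≡id) ⟩
      g ∘ (q ∘ u)    ≡⟨ ∘-factor refl ⟩
      (g ∘ q) ∘ u    ≡⟨ cong (_∘ u) (sym commutes) ⟩
      (f ∘ p) ∘ u    ≡⟨ assoc f p u ⟩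
      f ∘ (p ∘ u)    ∎)
      where open ≡-Reasoning
    graph : (h : HomOver g f) →
            Σ[ u ∈ Hom C U ] ((p ∘ u ≡ proj₁ h) × (q ∘ u ≡ id) ×
              (∀ u′ → p ∘ u′ ≡ proj₁ h → q ∘ u′ ≡ id → u′ ≡ u))
    graph (h , g≡fh) = universal h id (trans (sym g≡fh) (sym (identityʳ g)))
    from : HomOver g f → Section q
    from h = proj₁ (graph h) , proj₁ (proj₂ (proj₂ (graph h)))
    to∘from : ∀ h → to (from h) ≡ h
    to∘from h = Σ-≡-irrelevant Hom-isSet (proj₁ (proj₂ (graph h)))
    from∘to : ∀ u → from (to u) ≡ u
    from∘to (u , qu≡id) =
      Σ-≡-irrelevant Hom-isSet (sym (proj₂ (proj₂ (proj₂ (graph (to (u , qu≡id))))) u refl qu≡id))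

n≡n*n⇒n≡1 : ∀ {n} → 1 ≤ n → n ≡ n * n → n ≡ 1
n≡n*n⇒n≡1 {suc n} _ eq = sym (*-cancelˡ-≡ 1 (suc n) (suc n) (trans (*-identityʳ (suc n)) eq))

Fin-≤1-subsingleton : ∀ {n} → n ≤ 1 → (x y : Fin n) → x ≡ y
Fin-≤1-subsingleton (s≤s z≤n) zero zero = refl

module _ {o ℓ} (G : GaloisSetting o ℓ) where
  open GaloisSetting G
  open Category 𝐂
  open CatNotions 𝐂

  deg-id : ∀ {X} (d : 𝐃ob X) → deg d (id {X}) ≡ 1
  deg-id d = n≡n*n⇒n≡1 (deg-pos d id) (trans (cong (deg d) (sym (identityˡ id))) (G4-mult d d id id))

  retraction⇒deg≡1 : ∀ {X Y} (dX : 𝐃ob X) (dY : 𝐃ob Y) (h : Hom X Y) (k : Hom Y X) →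
                     h ∘ k ≡ id → deg dY h ≡ 1
  retraction⇒deg≡1 dX dY h k hk≡id = m*n≡1⇒m≡1 (deg dY h) (deg dX k)
    (trans (sym (G4-mult dX dY k h)) (trans (cong (deg dY) hk≡id) (deg-id dY)))

  deg≡1⇒Σidx-subsingleton : ∀ {X Y} (dY : 𝐃ob Y) (h : Hom X Y) → deg dY h ≡ 1 →
                            (i j : Σidx X) → i ≡ j
  deg≡1⇒Σidx-subsingleton dY h deg≡1 i j with G4-sum dY h
  ... | n , e , deg≡sum = begin
    i              ≡⟨ sym (strictlyInverseˡ i) ⟩
    to (from i)    ≡⟨ cong to (Fin-≤1-subsingleton n≤1 (from i) (from j)) ⟩
    to (from j)    ≡⟨ strictlyInverseˡ j ⟩
    j              ∎
    where
    open ≡-Reasoning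
    open Inverse e
    n≤1 : n ≤ 1
    n≤1 = ≤-trans (length≤sumFin n (λ k → deg-pos dY _)) (≤-reflexive (trans (sym deg≡sum) deg≡1))

  Σarr-jointly-epic : ∀ {U Y} (a b : Hom U Y) → (∀ j → a ∘ Σarr j ≡ b ∘ Σarr j) →
                      ∀ {Z} → 𝐃ob Z → (w : Hom Z U) → a ∘ w ≡ b ∘ w
  Σarr-jointly-epic a b agree dZ w with G3-exists dZ w
  ... | j , k , w≡jk =
    trans (∘-factor 𝐂 w≡jk) (trans (cong (_∘ k) (agree j)) (sym (∘-factor 𝐂 w≡jk)))

  deg≡1⇒monic : ∀ {X Y} (dX : 𝐃ob X) (dY : 𝐃ob Y) (h : Hom X Y) → deg dY h ≡ 1 →
                ∀ {Z} → 𝐃ob Z → (u v : Hom Z X) → h ∘ u ≡ h ∘ v → u ≡ v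
  deg≡1⇒monic dX dY h deg≡1 dZ u v hu≡hv with G1 dY dX dX h h
  ... | P , p₁ , p₂ , kernelPair@(_ , universal)
    with universal u v hu≡hv | universal id id refl
  ... | w , p₁w≡u , p₂w≡v , _ | δ , p₁δ≡id , p₂δ≡id , _
    with G3-exists dX δ
  ... | j₀ , k₀ , δ≡j₀k₀ = begin
    u       ≡⟨ sym p₁w≡u ⟩
    p₁ ∘ w  ≡⟨ Σarr-jointly-epic p₁ p₂ legs-agree dZ w ⟩
    p₂ ∘ w  ≡⟨ p₂w≡v ⟩
    v       ∎
    where
    open ≡-Reasoning
    legs-agree-at-j₀ : p₁ ∘ Σarr j₀ ≡ p₂ ∘ Σarr j₀
    legs-agree-at-j₀ = G2-epi dX (Σdom𝐃 j₀) dX k₀ (p₁ ∘ Σarr j₀) (p₂ ∘ Σarr j₀) (begin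
      (p₁ ∘ Σarr j₀) ∘ k₀  ≡⟨ sym (∘-factor 𝐂 δ≡j₀k₀) ⟩
      p₁ ∘ δ               ≡⟨ trans p₁δ≡id (sym p₂δ≡id) ⟩
      p₂ ∘ δ               ≡⟨ ∘-factor 𝐂 δ≡j₀k₀ ⟩
      (p₂ ∘ Σarr j₀) ∘ k₀  ∎)
    deg-p₁≡1 : deg dX p₁ ≡ 1
    deg-p₁≡1 = trans (sym (proj₂ (G4-pb dY dX dX h h p₁ p₂ kernelPair))) deg≡1
    legs-agree : ∀ j → p₁ ∘ Σarr j ≡ p₂ ∘ Σarr j
    legs-agree j = subst (λ j → p₁ ∘ Σarr j ≡ p₂ ∘ Σarr j)
      (deg≡1⇒Σidx-subsingleton dX p₁ deg-p₁≡1 j₀ j) legs-agree-at-j₀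

  deg≡1⇒IsIso : ∀ {X Y} (dX : 𝐃ob X) (dY : 𝐃ob Y) (h : Hom X Y) → deg dY h ≡ 1 → IsIso h
  deg≡1⇒IsIso dX dY h deg≡1 = G2-mono dX dY h (deg≡1⇒monic dX dY h deg≡1)

  DegreeOne : ∀ {U C} → 𝐃ob C → Hom U C → Set ℓ
  DegreeOne {U} dC q = Σ[ i ∈ Σidx U ] deg dC (q ∘ Σarr i) ≡ 1

  DegreeOne↔Section : ∀ {U C} (dC : 𝐃ob C) (q : Hom U C) → DegreeOne dC q ↔ Section 𝐂 q
  DegreeOne↔Section dC q = mk↔ₛ′ to from to∘from from∘to
    where
    inverse : ((i , _) : DegreeOne dC q) → IsIso (q ∘ Σarr i)
    inverse (i , e) = deg≡1⇒IsIso (Σdom𝐃 i) dC (q ∘ Σarr i) e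
    to : DegreeOne dC q → Section 𝐂 q
    to (i , e) = Σarr i ∘ proj₁ (inverse (i , e)) ,
                 trans (∘-factor 𝐂 refl) (proj₂ (proj₂ (inverse (i , e))))
    from : Section 𝐂 q → DegreeOne dC q
    from (u , qu≡id) with G3-exists dC u
    ... | i , k , u≡ik =
      i , retraction⇒deg≡1 (Σdom𝐃 i) dC (q ∘ Σarr i) k (trans (sym (∘-factor 𝐂 u≡ik)) qu≡id)
    to∘from : ∀ u → to (from u) ≡ u
    to∘from (u , qu≡id) with G3-exists dC u
    ... | i , k , u≡ik = Σ-≡-irrelevant Hom-isSet (begin
      Σarr i ∘ proj₁ iso  ≡⟨ cong (Σarr i ∘_) r≡k ⟩
      Σarr i ∘ k          ≡⟨ sym u≡ik ⟩
      u                   ∎)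
      where
      open ≡-Reasoning
      qik≡id : (q ∘ Σarr i) ∘ k ≡ id
      qik≡id = trans (sym (∘-factor 𝐂 u≡ik)) qu≡id
      iso : IsIso (q ∘ Σarr i)
      iso = inverse (i , retraction⇒deg≡1 (Σdom𝐃 i) dC (q ∘ Σarr i) k qik≡id)
      r≡k : proj₁ iso ≡ k
      r≡k = left-inverse≡right-inverse 𝐂 (proj₁ (proj₂ iso)) qik≡id
    from∘to : ∀ x → from (to x) ≡ x
    from∘to (i , e) with G3-exists dC (Σarr i ∘ proj₁ (inverse (i , e)))
    ... | i′ , k , u≡i′k = Σ-≡-irrelevant ≡-irrelevant (G3-unique dC _ i′ i (k , u≡i′k) (_ , refl))

theorem3p10 : ∀ {o ℓ} (G : GaloisSetting o ℓ) →
  let open GaloisSetting G in let open Category 𝐂 in let open CatNotions 𝐂 in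
  ∀ {A B C U : Obj} (dA : 𝐃ob A) (dB : 𝐃ob B) (dC : 𝐃ob C)
    (f : Hom B A) (g : Hom C A) (p : Hom U B) (q : Hom U C) →
  IsPullback f g p q →
  -- each q ∘ i of degree 1 is an isomorphism
  (∀ (i : Σidx U) → deg dC (q ∘ Σarr i) ≡ 1 → IsIso (q ∘ Σarr i)) ×
  -- Φ : { i ∈ Σ(U) | deg (q ∘ i) = 1 } → Hom(g , f), i ↦ p ∘ i ∘ (q ∘ i)⁻¹, is a bijection
  (Σ[ Φ ∈ (Σ[ i ∈ Σidx U ] deg dC (q ∘ Σarr i) ≡ 1 → HomOver g f) ]
     ((∀ (i : Σidx U) (e : deg dC (q ∘ Σarr i) ≡ 1) (r : Hom C (Σdom i)) →
         IsInverse (q ∘ Σarr i) r → proj₁ (Φ (i , e)) ≡ p ∘ Σarr i ∘ r) ×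
      Bijective _≡_ _≡_ Φ)) ×
  -- |Hom(g , f)| ≤ deg f, with equality iff deg (q ∘ i) = 1 for all i ∈ Σ(U)
  (Σ[ n ∈ ℕ ] Σ[ _ ∈ (Fin n ↔ HomOver g f) ]
     ((n ≤ deg dA f) ×
      (n ≡ deg dA f ⇔ (∀ (i : Σidx U) → deg dC (q ∘ Σarr i) ≡ 1))))
theorem3p10 G {C = C} dA dB dC f g p q pullback =
  isIso , (Inverse.to Φ , Φ-formula , Bijection.bijective (Inverse⇒Bijection Φ)) , count
  where
  open GaloisSetting G
  open Category 𝐂
  open CatNotions 𝐂
  isIso : ∀ i → deg dC (q ∘ Σarr i) ≡ 1 → IsIso (q ∘ Σarr i)
  isIso i = deg≡1⇒IsIso G (Σdom𝐃 i) dC (q ∘ Σarr i)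
  Φ : DegreeOne G dC q ↔ HomOver g f
  Φ = ↔-trans (DegreeOne↔Section G dC q) (Section↔HomOver 𝐂 pullback)
  Φ-formula : ∀ i e (r : Hom C (Σdom i)) → IsInverse (q ∘ Σarr i) r →
              proj₁ (Inverse.to Φ (i , e)) ≡ p ∘ Σarr i ∘ r
  Φ-formula i e r (_ , qir≡id) =
    cong (λ r′ → p ∘ Σarr i ∘ r′) (left-inverse≡right-inverse 𝐂 (proj₁ (proj₂ (isIso i e))) qir≡id)
  count : Σ[ n ∈ ℕ ] Σ[ _ ∈ (Fin n ↔ HomOver g f) ]
            ((n ≤ deg dA f) × (n ≡ deg dA f ⇔ (∀ i → deg dC (q ∘ Σarr i) ≡ 1)))
  count with G4-sum dC q
  ... | m , e , deg-q≡sum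
    with ones-count e (λ i → deg dC (q ∘ Σarr i)) (λ i → deg-pos dC _)
                   (trans (proj₁ (G4-pb dA dB dC f g p q pullback)) deg-q≡sum)
  ... | n , ones↔ , bounds = n , ↔-trans ones↔ Φ , bounds
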